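{- Let $H$ be a hypergraph and let $(C,P)$ be a best pair in $H$ with $C = v_1, e_1, \ldots, v_s, e_s, v_1$ and $P = u_1, f_1, \ldots, f_{\ell-1}, u_\ell$. Let $B_1=\{e_j\in E(C): u_1\in e_j\}$ and $B_\ell=\{e_j\in E(C): u_\ell\in e_j\}$. Then for every $e_i \in B_1$ and $e_j \in B_\ell$, either $i=j$ or $|i - j| \geq \ell$.
   Context: A hypergraph is a family of distinct subsets (edges) of a vertex set. A Berge cycle of length $s$ is a list $v_1,e_1,\ldots,v_s,e_s,v_1$ of $s$ distinct vertices and $s$ distinct edges with $\{v_i,v_{i+1}\}\subseteq e_i$ (indices mod $s$); a Berge path $u_1,f_1,\ldots,f_{\ell-1},u_\ell$ consists of $\ell$ distinct vertices and $\ell-1$ distinct edges with $\{u_i,u_{i+1}\}\subseteq f_i$ (a single vertex is allowed); $V(\cdot)$, $E(\cdot)$ denote the listed vertices and edges. A pair $(C,P)$ consists of a Berge cycle $C$ and a Berge path $P$ with $V(C)\cap V(P)=\emptyset$ and $E(C)\cap E(P)=\emptyset$. $(C,P)$ is better than $(C',P')$ if, comparing lexicographically in this order, it has larger value of: (i) $|E(C)|$; (ii) $|E(P)|$; (iii) $\sum_{e\in E(C)}|e\cap V(P)|$; (iv) $\sum_{f\in E(P)}|f\cap V(P)|$. A best pair is one such that no pair is better. Here $i,j\in\{1,\ldots,s\}$. -}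

module Defs where

open import Data.Nat using (ℕ; zero; suc; _+_; _<_; _≤_)
open import Data.Nat.DivMod using (_mod_)
open import Data.Fin using (Fin; zero; suc; toℕ; inject₁; fromℕ) renaming (_≟_ to _≟ᶠ_)
open import Data.Fin.Properties using (any?)
open import Data.Fin.Subset using (Subset; _∈_; _∩_; ∣_∣)
open import Data.Vec using (tabulate)
open import Data.Product using (_×_)
open import Data.Sum using (_⊎_)
open import Relation.Binary.PropositionalEquality using (_≡_; _≢_)
open import Relation.Nullary using (¬_)
open import Relation.Nullary.Decidable using (⌊_⌋)
open import Function.Definitions using (Injective)

record Hypergraph : Set where
  field
    n     : ℕ
    m     : ℕ
    edge  : Fin m → Subset n
    edge-distinct : Injective _≡_ _≡_ edge
open Hypergraph public

next : ∀ {s'} → Fin (suc s') → Fin (suc s')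
next {s'} i = suc (toℕ i) mod (suc s')

-- Berge cycle v_1,e_1,...,v_s,e_s,v_1 with s = suc s' (indices 0-based).
record BergeCycle (H : Hypergraph) : Set where
  field
    s'    : ℕ
    v     : Fin (suc s') → Fin (n H)
    e     : Fin (suc s') → Fin (m H)
    v-inj : Injective _≡_ _≡_ v
    e-inj : Injective _≡_ _≡_ e
    inc₁  : ∀ i → v i ∈ edge H (e i)
    inc₂  : ∀ i → v (next i) ∈ edge H (e i)
  len : ℕ
  len = suc s'
open BergeCycle public

-- Berge path u_1,f_1,...,f_{ℓ-1},u_ℓ with ℓ = suc k vertices and k edges.
record BergePath (H : Hypergraph) : Set where
  field
    k     : ℕ
    u     : Fin (suc k) → Fin (n H)
    f     : Fin k → Fin (m H)
    u-inj : Injective _≡_ _≡_ u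
    f-inj : Injective _≡_ _≡_ f
    inc₁  : ∀ a → u (inject₁ a) ∈ edge H (f a)
    inc₂  : ∀ a → u (suc a) ∈ edge H (f a)
open BergePath public

VP : ∀ {H} → BergePath H → Subset (n H)
VP P = tabulate (λ x → ⌊ any? (λ a → u P a ≟ᶠ x) ⌋)

record Pair (H : Hypergraph) : Set where
  field
    cyc  : BergeCycle H
    pth  : BergePath H
    vdisj : ∀ i a → v cyc i ≢ u pth a
    edisj : ∀ i a → e cyc i ≢ f pth a
open Pair public

ΣFin : ∀ {k} → (Fin k → ℕ) → ℕ
ΣFin {zero}  g = 0
ΣFin {suc k} g = g zero + ΣFin (λ a → g (suc a))

score₁ score₂ score₃ score₄ : ∀ {H} → Pair H → ℕ
score₁ p = len (cyc p)
score₂ p = k (pth p)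
score₃ {H} p = ΣFin (λ i → ∣ edge H (e (cyc p) i) ∩ VP (pth p) ∣)
score₄ {H} p = ΣFin (λ a → ∣ edge H (f (pth p) a) ∩ VP (pth p) ∣)

Better : ∀ {H} → Pair H → Pair H → Set
Better p q =
  (score₁ q < score₁ p) ⊎
  (score₁ q ≡ score₁ p × ((score₂ q < score₂ p) ⊎
  (score₂ q ≡ score₂ p × ((score₃ q < score₃ p) ⊎
  (score₃ q ≡ score₃ p × score₄ q < score₄ p)))))

BestPair : ∀ {H} → Pair H → Set
BestPair {H} p = ∀ (q : Pair H) → ¬ Better q p

-- Only criterion (i) of a best pair is needed. If i < j and j − i < ℓ, the
-- path f_1, …, f_{ℓ−1} followed by the arc e_j, e_{j+1}, …, e_i of C (indices
-- mod s) is a Berge cycle with (ℓ − 1) + (s − (j − i) + 1) > s edges, and the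
-- vertex v_j lies off it; with the one-vertex path v_j this is a pair with a
-- longer cycle. The case j < i is the same argument for the reversed path.
module Submission where

open import Defs
open import Data.Nat using (ℕ; suc; _≤_; ∣_-_∣)
open import Data.Fin using (Fin; zero; toℕ; fromℕ)
open import Data.Fin.Subset using (_∈_)
open import Data.Sum using (_⊎_)
open import Relation.Binary.PropositionalEquality using (_≡_)

open import Data.Nat using (zero; _+_; _*_; _∸_; _<_; _%_; NonZero; s≤s; z<s; _<?_)
open import Data.Nat.Properties
open import Data.Nat.DivMod using (_mod_; %-distribˡ-+; m%n%n≡m%n; [m+n]%n≡m%n; [m+kn]%n≡m%n; m<n⇒m%n≡m; n%n≡0)
open import Data.Nat.Tactic.RingSolver using (solve-∀)
open import Data.Fin using (fromℕ<; inject₁; opposite)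
import Data.Fin as F
open import Data.Fin.Properties using (toℕ-injective; toℕ<n; toℕ-fromℕ<; fromℕ<-toℕ; toℕ-inject₁; toℕ-fromℕ; opposite-prop; opposite-involutive)
open import Data.Empty using (⊥-elim)
open import Data.Product using (Σ-syntax; _,_)
open import Data.Sum using (inj₁; inj₂)
open import Function.Definitions using (Injective)
open import Relation.Binary.Definitions using (tri<; tri≈; tri>)
open import Relation.Binary.PropositionalEquality using (_≢_; refl; sym; trans; cong; subst; subst₂; module ≡-Reasoning)
open import Relation.Nullary using (¬_; yes; no)

private variable
  A : Set

-- Arithmetic modulo n

toℕ-mod : ∀ x n .{{_ : NonZero n}} → toℕ (x mod n) ≡ x % n
toℕ-mod x n = toℕ-fromℕ< _

%≡⇒mod≡ : ∀ {x y n} .{{_ : NonZero n}} → x % n ≡ y % n → x mod n ≡ y mod n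
%≡⇒mod≡ {x} {y} {n} eq = toℕ-injective (trans (toℕ-mod x n) (trans eq (sym (toℕ-mod y n))))

mod-toℕ : ∀ {s} (i : Fin (suc s)) → toℕ i mod suc s ≡ i
mod-toℕ {s} i = toℕ-injective (trans (toℕ-mod (toℕ i) (suc s)) (m<n⇒m%n≡m (toℕ<n i)))

+-cancelˡ-% : ∀ b {n x y} .{{_ : NonZero n}} → x < n → y < n → (b + x) % n ≡ (b + y) % n → x ≡ y
+-cancelˡ-% b {n@(suc n′)} {x} {y} x<n y<n eq = begin
  x                                   ≡⟨ m<n⇒m%n≡m x<n ⟨
  x % n                               ≡⟨ cancel x ⟨
  ((b + x) % n + n′ * b % n) % n      ≡⟨ cong (λ r → (r + n′ * b % n) % n) eq ⟩
  ((b + y) % n + n′ * b % n) % n      ≡⟨ cancel y ⟩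
  y % n                               ≡⟨ m<n⇒m%n≡m y<n ⟩
  y                                   ∎
  where
  open ≡-Reasoning
  shuffle : ∀ c z m → c + z + m * c ≡ z + c * suc m
  shuffle = solve-∀
  -- adding n′ * b undoes the shift by b, since b + n′ * b is a multiple of n
  cancel : ∀ z → ((b + z) % n + n′ * b % n) % n ≡ z % n
  cancel z = begin
    ((b + z) % n + n′ * b % n) % n ≡⟨ %-distribˡ-+ (b + z) (n′ * b) n ⟨
    (b + z + n′ * b) % n           ≡⟨ cong (_% n) (shuffle b z n′) ⟩
    (z + b * n) % n                ≡⟨ [m+kn]%n≡m%n z b n ⟩
    z % n                          ∎

[1+m%n]%n≡[1+m]%n : ∀ x n .{{_ : NonZero n}} → suc (x % n) % n ≡ suc x % n
[1+m%n]%n≡[1+m]%n x n = begin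
  (1 + x % n) % n         ≡⟨ %-distribˡ-+ 1 (x % n) n ⟩
  (1 % n + x % n % n) % n ≡⟨ cong (λ r → (1 % n + r) % n) (m%n%n≡m%n x n) ⟩
  (1 % n + x % n) % n     ≡⟨ %-distribˡ-+ 1 x n ⟨
  (1 + x) % n             ∎
  where open ≡-Reasoning

next-mod : ∀ {s} x → next (x mod suc s) ≡ suc x mod suc s
next-mod {s} x = %≡⇒mod≡ {suc (toℕ (x mod suc s))} {suc x}
  (trans (cong (λ r → suc r % suc s) (toℕ-mod x (suc s))) ([1+m%n]%n≡[1+m]%n x (suc s)))

toℕ-next : ∀ {s} (i : Fin (suc s)) → toℕ i < s → toℕ (next i) ≡ suc (toℕ i)
toℕ-next {s} i i<s = trans (toℕ-mod (suc (toℕ i)) (suc s)) (m<n⇒m%n≡m (s≤s i<s))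

toℕ-next-last : ∀ {s} (i : Fin (suc s)) → toℕ i ≡ s → toℕ (next i) ≡ 0
toℕ-next-last {s} i i≡s = begin
  toℕ (next i)        ≡⟨ toℕ-mod (suc (toℕ i)) (suc s) ⟩
  suc (toℕ i) % suc s ≡⟨ cong (λ r → suc r % suc s) i≡s ⟩
  suc s % suc s       ≡⟨ n%n≡0 (suc s) ⟩
  0                   ∎
  where open ≡-Reasoning

-- Sequences indexed by ℕ

InjectiveBelow : ℕ → (ℕ → A) → Set
InjectiveBelow N g = ∀ {x y} → x < N → y < N → g x ≡ g y → x ≡ y

cyclic : ∀ {s} → (Fin (suc s) → A) → ℕ → A
cyclic {s = s} g x = g (x mod suc s)

cyclic-toℕ : ∀ {s} (g : Fin (suc s) → A) (i : Fin (suc s)) → cyclic g (toℕ i) ≡ g i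
cyclic-toℕ g i = cong g (mod-toℕ i)

cyclic-periodic : ∀ {s} (g : Fin (suc s) → A) x → cyclic g (x + suc s) ≡ cyclic g x
cyclic-periodic {s = s} g x = cong g (%≡⇒mod≡ {x + suc s} {x} ([m+n]%n≡m%n x (suc s)))

cyclic-arc-injective : ∀ {s} {g : Fin (suc s) → A} → Injective _≡_ _≡_ g →
  ∀ b → InjectiveBelow (suc s) (λ t → cyclic g (b + t))
cyclic-arc-injective {s = s} g-inj b {x} {y} x<s y<s eq = +-cancelˡ-% b x<s y<s
  (trans (sym (toℕ-mod (b + x) (suc s))) (trans (cong toℕ (g-inj eq)) (toℕ-mod (b + y) (suc s))))

infixr 5 _++_

_++_ : ∀ {K} → (Fin K → A) → (ℕ → A) → ℕ → A
_++_ {K = K} g h t with t <? K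
... | yes t<K = g (fromℕ< t<K)
... | no _    = h (t ∸ K)

++-toℕ : ∀ {K} (g : Fin K → A) (h : ℕ → A) (a : Fin K) → (g ++ h) (toℕ a) ≡ g a
++-toℕ {K = K} g h a with toℕ a <? K
... | yes a<K = cong g (fromℕ<-toℕ a a<K)
... | no a≮K  = ⊥-elim (a≮K (toℕ<n a))

++-+ : ∀ {K} (g : Fin K → A) (h : ℕ → A) (t : ℕ) → (g ++ h) (K + t) ≡ h t
++-+ {K = K} g h t with K + t <? K
... | yes K+t<K = ⊥-elim (m+n≮m K t K+t<K)
... | no _      = cong h (m+n∸m≡n K t)

data Split (K : ℕ) : ℕ → Set where
  inside : (a : Fin K) → Split K (toℕ a)
  beyond : (t : ℕ) → Split K (K + t)

split : ∀ K t → Split K t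
split K t with t <? K
... | yes t<K = subst (Split K) (toℕ-fromℕ< t<K) (inside (fromℕ< t<K))
... | no t≮K  = subst (Split K) (m+[n∸m]≡n (≮⇒≥ t≮K)) (beyond (t ∸ K))

++-injective : ∀ {K N} {g : Fin K → A} {h : ℕ → A} → Injective _≡_ _≡_ g → InjectiveBelow N h →
  (∀ a {t} → t < N → g a ≢ h t) → InjectiveBelow (K + N) (g ++ h)
++-injective {K = K} {N = N} {g = g} {h} g-inj h-inj apart {x} {y} x< y< eq
  with split K x | split K y
... | inside a | inside a′ =
  cong toℕ (g-inj (trans (sym (++-toℕ g h a)) (trans eq (++-toℕ g h a′))))
... | inside a | beyond t  =
  ⊥-elim (apart a (+-cancelˡ-< K t N y<) (trans (sym (++-toℕ g h a)) (trans eq (++-+ g h t))))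
... | beyond t | inside a  =
  ⊥-elim (apart a (+-cancelˡ-< K t N x<) (trans (sym (++-toℕ g h a)) (trans (sym eq) (++-+ g h t))))
... | beyond t | beyond t′ =
  cong (K +_) (h-inj (+-cancelˡ-< K t N x<) (+-cancelˡ-< K t′ N y<)
    (trans (sym (++-+ g h t)) (trans eq (++-+ g h t′))))

++-all : ∀ {K N} (P : A → Set) {g : Fin K → A} {h : ℕ → A} →
  (∀ a → P (g a)) → (∀ {t} → t < N → P (h t)) → ∀ {x} → x < K + N → P ((g ++ h) x)
++-all {K = K} {N = N} P {g} {h} Pg Ph {x} x< with split K x
... | inside a = subst P (sym (++-toℕ g h a)) (Pg a)
... | beyond t = subst P (sym (++-+ g h t)) (Ph (+-cancelˡ-< K t N x<))

-- Cycles, paths and pairs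

record CycleSequence (H : Hypergraph) (L : ℕ) : Set where
  field
    vertexAt         : ℕ → Fin (n H)
    edgeAt           : ℕ → Fin (m H)
    vertex-injective : InjectiveBelow (suc L) vertexAt
    edge-injective   : InjectiveBelow (suc L) edgeAt
    vertex∈edge      : ∀ {x} → x ≤ L → vertexAt x ∈ edge H (edgeAt x)
    next-vertex∈edge : ∀ {x} → x < L → vertexAt (suc x) ∈ edge H (edgeAt x)
    first∈last-edge  : vertexAt 0 ∈ edge H (edgeAt L)

toBergeCycle : ∀ {H L} → CycleSequence H L → BergeCycle H
toBergeCycle {H} {L} c = record
  { s'    = L
  ; v     = λ i → vertexAt (toℕ i)
  ; e     = λ i → edgeAt (toℕ i)
  ; v-inj = λ {i} {j} eq → toℕ-injective (vertex-injective (toℕ<n i) (toℕ<n j) eq)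
  ; e-inj = λ {i} {j} eq → toℕ-injective (edge-injective (toℕ<n i) (toℕ<n j) eq)
  ; inc₁  = λ i → vertex∈edge (≤-pred (toℕ<n i))
  ; inc₂  = next∈edge
  }
  where
  open CycleSequence c
  next∈edge : (i : Fin (suc L)) → vertexAt (toℕ (next i)) ∈ edge H (edgeAt (toℕ i))
  next∈edge i with m≤n⇒m<n∨m≡n (≤-pred (toℕ<n i))
  ... | inj₁ i<L = subst (λ x → vertexAt x ∈ edge H (edgeAt (toℕ i)))
                     (sym (toℕ-next i i<L)) (next-vertex∈edge i<L)
  ... | inj₂ i≡L = subst₂ (λ x y → vertexAt x ∈ edge H (edgeAt y))
                     (sym (toℕ-next-last i i≡L)) (sym i≡L) first∈last-edge

cyclic-inc₁ : ∀ {H} (C : BergeCycle H) x → cyclic (v C) x ∈ edge H (cyclic (e C) x)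
cyclic-inc₁ C x = inc₁ C (x mod len C)

cyclic-inc₂ : ∀ {H} (C : BergeCycle H) x → cyclic (v C) (suc x) ∈ edge H (cyclic (e C) x)
cyclic-inc₂ {H} C x = subst (λ w → v C w ∈ edge H (cyclic (e C) x)) (next-mod x) (inc₂ C (x mod len C))

trivialPath : ∀ {H} → Fin (n H) → BergePath H
trivialPath x = record
  { k = 0 ; u = λ _ → x ; f = λ () ; u-inj = λ { {zero} {zero} _ → refl }
  ; f-inj = λ { {()} } ; inc₁ = λ () ; inc₂ = λ () }

pairOffCycle : ∀ {H} (C : BergeCycle H) (x : Fin (n H)) → (∀ i → v C i ≢ x) → Pair H
pairOffCycle C x x∉C = record
  { cyc = C ; pth = trivialPath x ; vdisj = λ i _ → x∉C i ; edisj = λ _ () }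

opposite-injective : ∀ {k} → Injective _≡_ _≡_ (opposite {k})
opposite-injective {x = i} {j} eq =
  trans (sym (opposite-involutive i)) (trans (cong opposite eq) (opposite-involutive j))

opposite-inject₁ : ∀ {k} (a : Fin k) → opposite (inject₁ a) ≡ F.suc (opposite a)
opposite-inject₁ {k} a = toℕ-injective (begin
  toℕ (opposite (inject₁ a)) ≡⟨ opposite-prop (inject₁ a) ⟩
  k ∸ toℕ (inject₁ a)        ≡⟨ cong (k ∸_) (toℕ-inject₁ a) ⟩
  k ∸ toℕ a                  ≡⟨ +-∸-assoc 1 (toℕ<n a) ⟩
  suc (k ∸ suc (toℕ a))      ≡⟨ cong suc (opposite-prop a) ⟨
  toℕ (F.suc (opposite a))   ∎)
  where open ≡-Reasoning

opposite-fromℕ : ∀ k → opposite (fromℕ k) ≡ zero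
opposite-fromℕ k = toℕ-injective
  (trans (opposite-prop (fromℕ k)) (trans (cong (k ∸_) (toℕ-fromℕ k)) (n∸n≡0 k)))

reverse : ∀ {H} → BergePath H → BergePath H
reverse {H} P = record
  { k     = k P
  ; u     = λ a → u P (opposite a)
  ; f     = λ a → f P (opposite a)
  ; u-inj = λ eq → opposite-injective (u-inj P eq)
  ; f-inj = λ eq → opposite-injective (f-inj P eq)
  ; inc₁  = λ a → subst (λ w → u P w ∈ edge H (f P (opposite a)))
                    (sym (opposite-inject₁ a)) (inc₂ P (opposite a))
  ; inc₂  = λ a → inc₁ P (opposite a)
  }

reverse-last : ∀ {H} (P : BergePath H) → u (reverse P) (fromℕ (k P)) ≡ u P zero
reverse-last P = cong (u P) (opposite-fromℕ (k P))

reversePair : ∀ {H} → Pair H → Pair H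
reversePair p = record
  { cyc   = cyc p
  ; pth   = reverse (pth p)
  ; vdisj = λ i a → vdisj p i (opposite a)
  ; edisj = λ i a → edisj p i (opposite a)
  }

-- The detour through the path

module Detour {H : Hypergraph} (p : Pair H) {i j : Fin (len (cyc p))}
  (i<j : toℕ i < toℕ j) (short : toℕ j ∸ toℕ i ≤ k (pth p))
  (first∈eᵢ : u (pth p) zero ∈ edge H (e (cyc p) i))
  (last∈eⱼ : u (pth p) (fromℕ (k (pth p))) ∈ edge H (e (cyc p) j)) where

  private
    C = cyc p
    P = pth p
    K = k P
    S = len C
    i₀ = toℕ i
    j₀ = toℕ j
    d = j₀ ∸ i₀

  -- e_j, e_{j+1}, …, e_{j+M} = e_i is the arc of C that the detour keeps
  M : ℕ
  M = S ∸ d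

  d≤S : d ≤ S
  d≤S = ≤-trans (m∸n≤m j₀ i₀) (<⇒≤ (toℕ<n j))

  M<S : M < S
  M<S = ∸-monoʳ-< (m<n⇒0<n∸m i<j) d≤S

  j₀+M≡i₀+S : j₀ + M ≡ i₀ + S
  j₀+M≡i₀+S = begin
    j₀ + M       ≡⟨ cong (_+ M) (m+[n∸m]≡n (<⇒≤ i<j)) ⟨
    i₀ + d + M   ≡⟨ +-assoc i₀ d M ⟩
    i₀ + (d + M) ≡⟨ cong (i₀ +_) (m+[n∸m]≡n d≤S) ⟩
    i₀ + S       ∎
    where open ≡-Reasoning

  S≤K+M : S ≤ K + M
  S≤K+M = subst (_≤ K + M) (m+[n∸m]≡n d≤S) (+-monoˡ-≤ M short)

  arcVertex : ℕ → Fin (n H)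
  arcVertex t = cyclic (v C) (j₀ + suc t)

  arcEdge : ℕ → Fin (m H)
  arcEdge t = cyclic (e C) (j₀ + t)

  -- position K + t carries the edge e_{j+t} and, for t ≥ 1, the vertex v_{j+t}
  vertexAt : ℕ → Fin (n H)
  vertexAt = u P ++ arcVertex

  edgeAt : ℕ → Fin (m H)
  edgeAt = f P ++ arcEdge

  arcEdge-first : arcEdge 0 ≡ e C j
  arcEdge-first = trans (cong (cyclic (e C)) (+-identityʳ j₀)) (cyclic-toℕ (e C) j)

  arcEdge-last : arcEdge M ≡ e C i
  arcEdge-last = begin
    cyclic (e C) (j₀ + M) ≡⟨ cong (cyclic (e C)) j₀+M≡i₀+S ⟩
    cyclic (e C) (i₀ + S) ≡⟨ cyclic-periodic (e C) i₀ ⟩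
    cyclic (e C) i₀       ≡⟨ cyclic-toℕ (e C) i ⟩
    e C i                 ∎
    where open ≡-Reasoning

  arcVertex-injective : InjectiveBelow M arcVertex
  arcVertex-injective x<M y<M eq = suc-injective
    (cyclic-arc-injective (v-inj C) j₀ (≤-<-trans x<M M<S) (≤-<-trans y<M M<S) eq)

  arcEdge-injective : InjectiveBelow (suc M) arcEdge
  arcEdge-injective x≤M y≤M =
    cyclic-arc-injective (e-inj C) j₀ (<-≤-trans x≤M M<S) (<-≤-trans y≤M M<S)

  arcVertex≢vⱼ : ∀ t → t < M → arcVertex t ≢ v C j
  arcVertex≢vⱼ t t<M eq = 1+n≢0 (cyclic-arc-injective (v-inj C) j₀ (≤-<-trans t<M M<S) z<s
    (trans eq (sym (trans (cong (cyclic (v C)) (+-identityʳ j₀)) (cyclic-toℕ (v C) j)))))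

  incident : ∀ x y {w g} → vertexAt x ≡ w → edgeAt y ≡ g → w ∈ edge H g →
    vertexAt x ∈ edge H (edgeAt y)
  incident _ _ refl refl w∈g = w∈g

  vertexAt∈edgeAt : ∀ x → vertexAt x ∈ edge H (edgeAt x)
  vertexAt∈edgeAt x with split K x
  ... | inside a = incident (toℕ a) (toℕ a)
    (trans (cong vertexAt (sym (toℕ-inject₁ a))) (++-toℕ (u P) arcVertex (inject₁ a)))
    (++-toℕ (f P) arcEdge a) (inc₁ P a)
  ... | beyond zero = incident (K + 0) (K + 0)
    (trans (cong vertexAt (trans (+-identityʳ K) (sym (toℕ-fromℕ K))))
           (++-toℕ (u P) arcVertex (fromℕ K)))
    (trans (++-+ (f P) arcEdge 0) arcEdge-first) last∈eⱼ
  ... | beyond (suc t) = incident (K + suc t) (K + suc t)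
    (trans (cong vertexAt (+-suc K t)) (++-+ (u P) arcVertex t))
    (++-+ (f P) arcEdge (suc t)) (cyclic-inc₁ C (j₀ + suc t))

  next-vertexAt∈edgeAt : ∀ x → vertexAt (suc x) ∈ edge H (edgeAt x)
  next-vertexAt∈edgeAt x with split K x
  ... | inside a = incident (suc (toℕ a)) (toℕ a)
    (++-toℕ (u P) arcVertex (F.suc a)) (++-toℕ (f P) arcEdge a) (inc₂ P a)
  ... | beyond t = incident (suc (K + t)) (K + t)
    (trans (++-+ (u P) arcVertex t) (cong (cyclic (v C)) (+-suc j₀ t)))
    (++-+ (f P) arcEdge t) (cyclic-inc₂ C (j₀ + t))

  detour : CycleSequence H (K + M)
  detour = record
    { vertexAt         = vertexAt
    ; edgeAt           = edgeAt
    ; vertex-injective = ++-injective (u-inj P) arcVertex-injective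
                           (λ a _ eq → vdisj p _ a (sym eq))
    ; edge-injective   = subst (λ N → InjectiveBelow N edgeAt) (+-suc K M)
                           (++-injective (f-inj P) arcEdge-injective (λ a _ eq → edisj p _ a (sym eq)))
    ; vertex∈edge      = λ _ → vertexAt∈edgeAt _
    ; next-vertex∈edge = λ _ → next-vertexAt∈edgeAt _
    ; first∈last-edge  = incident 0 (K + M) (++-toℕ (u P) arcVertex zero)
                           (trans (++-+ (f P) arcEdge M) arcEdge-last) first∈eᵢ
    }

  vⱼ∉detour : ∀ {x} → x < suc K + M → vertexAt x ≢ v C j
  vⱼ∉detour = ++-all (_≢ v C j) (λ a eq → vdisj p j a (sym eq)) (λ {t} → arcVertex≢vⱼ t)

  longerPair : Σ[ q ∈ Pair H ] len C < len (cyc q)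
  longerPair =
    pairOffCycle (toBergeCycle detour) (v C j) (λ i′ → vⱼ∉detour (toℕ<n i′)) , s≤s S≤K+M

HasLongestCycle : ∀ {H} → Pair H → Set
HasLongestCycle {H} p = ∀ (q : Pair H) → ¬ len (cyc p) < len (cyc q)

best⇒longest : ∀ {H} {p : Pair H} → BestPair p → HasLongestCycle p
best⇒longest best q longer = best q (inj₁ longer)

path-shorter-than-gap : ∀ {H} (p : Pair H) → HasLongestCycle p → {i j : Fin (len (cyc p))} →
  toℕ i < toℕ j →
  u (pth p) zero ∈ edge H (e (cyc p) i) →
  u (pth p) (fromℕ (k (pth p))) ∈ edge H (e (cyc p) j) →
  k (pth p) < toℕ j ∸ toℕ i
path-shorter-than-gap p longest i<j first∈eᵢ last∈eⱼ = ≰⇒> λ short →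
  let (q , longer) = Detour.longerPair p i<j short first∈eᵢ last∈eⱼ in longest q longer

claim3p3 : (H : Hypergraph) (p : Pair H) → BestPair p →
    (i j : Fin (len (cyc p))) →
    u (pth p) zero ∈ edge H (e (cyc p) i) →
    u (pth p) (fromℕ (k (pth p))) ∈ edge H (e (cyc p) j) →
    i ≡ j ⊎ suc (k (pth p)) ≤ ∣ toℕ i - toℕ j ∣
claim3p3 H p best i j first∈eᵢ last∈eⱼ with <-cmp (toℕ i) (toℕ j)
... | tri≈ _ i≡j _ = inj₁ (toℕ-injective i≡j)
... | tri< i<j _ _ = inj₂ (subst (suc (k (pth p)) ≤_) (sym (m≤n⇒∣m-n∣≡n∸m (<⇒≤ i<j)))
  (path-shorter-than-gap p (best⇒longest {p = p} best) i<j first∈eᵢ last∈eⱼ))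
-- reversing the path leaves the cycle, hence HasLongestCycle, unchanged
... | tri> _ _ j<i = inj₂ (subst (suc (k (pth p)) ≤_) (sym (m≤n⇒∣n-m∣≡n∸m (<⇒≤ j<i)))
  (path-shorter-than-gap (reversePair p) (best⇒longest {p = p} best) j<i last∈eⱼ
    (subst (λ w → w ∈ edge H (e (cyc p) i)) (sym (reverse-last (pth p))) first∈eᵢ)))
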